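{- For every positive integer $k$, every chordal bipartite graph that does not contain $K_{k,k}$ as a subgraph is $(k-1)$-degenerate.
   Context: A bipartite graph is chordal bipartite if every cycle of length at least six has a chord. A graph is $d$-degenerate if every (nonempty) induced subgraph has a vertex of degree at most $d$. -}

module Defs where

open import Data.Nat using (ℕ; zero; suc; _≤_; _∸_)
open import Data.Nat.DivMod using (_%_; m%n<n)
open import Data.Bool using (Bool; true; false; _∧_)
open import Data.Fin using (Fin; toℕ; fromℕ<)
open import Data.Fin.Subset using (Subset; _∈_; Nonempty; ∣_∣)
open import Data.Vec using (tabulate; lookup)
open import Data.Sum using (_⊎_)
open import Data.Product using (Σ; ∃; _×_; _,_)
open import Function.Definitions using (Injective)
open import Relation.Binary.PropositionalEquality using (_≡_; _≢_)
open import Relation.Nullary using (¬_)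

record Graph (n : ℕ) : Set where
  field
    adj    : Fin n → Fin n → Bool
    sym    : ∀ u v → adj u v ≡ adj v u
    irrefl : ∀ v → adj v v ≡ false

open Graph public

Adj : ∀ {n} → Graph n → Fin n → Fin n → Set
Adj G u v = adj G u v ≡ true

Bipartite : ∀ {n} → Graph n → Set
Bipartite {n} G = Σ (Fin n → Bool) λ c → ∀ u v → Adj G u v → c u ≢ c v

cnext : ∀ {m} → Fin (suc m) → Fin (suc m)
cnext {m} i = fromℕ< (m%n<n (suc (toℕ i)) (suc m))

-- A cycle of length (suc m) in G: distinct vertices v₀,…,v_m with
-- v_i adjacent to v_{i+1 mod (suc m)} (length ≥ 3 is imposed where used).
record Cycle {n : ℕ} (G : Graph n) (m : ℕ) : Set where
  field
    vert     : Fin (suc m) → Fin n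
    distinct : Injective _≡_ _≡_ vert
    edges    : ∀ i → Adj G (vert i) (vert (cnext i))

open Cycle public

Consecutive : ∀ {m} → Fin (suc m) → Fin (suc m) → Set
Consecutive i j = (j ≡ cnext i) ⊎ (i ≡ cnext j)

HasChord : ∀ {n} {G : Graph n} {m} → Cycle G m → Set
HasChord {G = G} {m = m} C =
  Σ (Fin (suc m)) λ i → Σ (Fin (suc m)) λ j →
    ¬ Consecutive i j × i ≢ j × Adj G (vert C i) (vert C j)

ChordalBipartite : ∀ {n} → Graph n → Set
ChordalBipartite G =
  Bipartite G × (∀ m → 6 ≤ suc m → (C : Cycle G m) → HasChord C)

ContainsKkk : ∀ {n} → Graph n → ℕ → Set
ContainsKkk {n} G k =
  Σ (Fin k → Fin n) λ a → Σ (Fin k → Fin n) λ b →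
    Injective _≡_ _≡_ a × Injective _≡_ _≡_ b ×
    (∀ i j → a i ≢ b j) × (∀ i j → Adj G (a i) (b j))

degreeIn : ∀ {n} → Graph n → Subset n → Fin n → ℕ
degreeIn G S v = ∣ tabulate (λ u → lookup S u ∧ adj G v u) ∣

Degenerate : ∀ {n} → ℕ → Graph n → Set
Degenerate {n} d G =
  (S : Subset n) → Nonempty S → ∃ λ v → v ∈ S × degreeIn G S v ≤ d

module Submission where

-- In a chordal bipartite graph every vertex set W has a weakly
-- simplicial vertex x: the W-neighbourhoods of the W-neighbours of x form a chain under
-- inclusion. To make the induction on |W| go through, x is sought in colour class false and
-- outside the neighbourhood of a given vertex y₀. After the easy reductions (deleting a vertex
-- of colour true that is dominated by y₀ or sees all of class false), one takes y₁ of colour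
-- true seeing the most of N₀ = N(y₀) ∩ W; if y₁ misses some a ∈ N₀, a shortest path from y₁
-- to N(a) leads, via y₀ and a, to a chordless cycle of length ≥ 6 or to a vertex seeing more
-- of N₀ than y₁.
--
-- Given a weakly simplicial x in S with at least k neighbours, let m be a neighbour of least
-- degree. The chain condition forces N(m) ⊆ N(y) for every neighbour y of x, so unless m has
-- fewer than k neighbours, k of them together with k neighbours of x span a K_{k,k}.

open import Defs hiding (sym)
open import Data.Bool using (Bool; true; false; _∧_; _∨_; not)
open import Data.Bool.Properties using (∧-conicalˡ; ∧-conicalʳ; ∧-zeroʳ; not-injective; ¬-not) renaming (_≟_ to _≟ᵇ_)
open import Data.Empty using (⊥; ⊥-elim)
open import Data.Fin using (Fin; toℕ; fromℕ<) renaming (zero to fzero; suc to fsuc)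
open import Data.Fin.Properties using (toℕ-injective; toℕ<n; toℕ-fromℕ<; any?; all?; ¬∀⟶∃¬)
  renaming (_≟_ to _≟ᶠ_; suc-injective to fsuc-injective)
open import Data.Fin.Subset using (Subset; _∈_; ∣_∣; _⊂_)
open import Data.Fin.Subset.Properties using (p⊂q⇒∣p∣<∣q∣; ∣p∣≤n)
open import Data.Nat using (ℕ; zero; suc; _+_; _∸_; _≤_; _<_; _≤′_; z≤n; s≤s; s≤s⁻¹; _≟_; _<?_; _≤?_)
open import Data.Nat.Base using (≤′-reflexive; ≤′-step)
open import Data.Nat.DivMod using (_%_; m<n⇒m%n≡m; n%n≡0)
open import Data.Nat.Induction using (<-rec; <-wellFounded)
open import Data.Nat.Properties
open import Data.Product using (Σ; ∃; _×_; _,_; proj₁; proj₂)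
open import Data.Sum using (_⊎_; inj₁; inj₂; reduce)
open import Data.Vec using (tabulate; lookup; _∷_; here; there)
open import Data.Vec.Properties using (lookup∘tabulate; []=⇒lookup; lookup⇒[]=)
open import Function using (_∘_; id; flip)
open import Function.Definitions using (Injective)
open import Induction.WellFounded using (module All)
open import Level using (0ℓ)
open import Relation.Binary.Construct.On as On using ()
open import Relation.Binary.Definitions using (Transitive; Total; tri<; tri≈; tri>)
open import Relation.Binary.PropositionalEquality
open import Relation.Nullary using (¬_; Dec; yes; no; does; _×-dec_; _→-dec_)
open import Relation.Nullary.Decidable using (dec-true; dec-false)
open import Relation.Unary using (Pred; Decidable)

∧-true⁺ : ∀ {a b} → a ≡ true → b ≡ true → a ∧ b ≡ true
∧-true⁺ refl refl = refl

∧-trueˡ : ∀ {a b} → a ∧ b ≡ true → a ≡ true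
∧-trueˡ = ∧-conicalˡ _ _

∧-trueʳ : ∀ {a b} → a ∧ b ≡ true → b ≡ true
∧-trueʳ = ∧-conicalʳ _ _

∨-trueˡ : ∀ {a b} → a ≡ true → a ∨ b ≡ true
∨-trueˡ refl = refl

∨-trueʳ : ∀ {a b} → b ≡ true → a ∨ b ≡ true
∨-trueʳ {true} _ = refl
∨-trueʳ {false} e = e

∨-true⁻ : ∀ {a b} → a ∨ b ≡ true → a ≡ true ⊎ b ≡ true
∨-true⁻ {true} _ = inj₁ refl
∨-true⁻ {false} e = inj₂ e

≡true⇒≢false : ∀ {a} → a ≡ true → a ≢ false
≡true⇒≢false refl ()

≢true⇒≡false : ∀ {a} → a ≢ true → a ≡ false
≢true⇒≡false {true} a≢true = ⊥-elim (a≢true refl)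
≢true⇒≡false {false} _ = refl

does-true⁻ : ∀ {A : Set} (a? : Dec A) → does a? ≡ true → A
does-true⁻ (yes a) _ = a

¬-→ : ∀ {A B : Set} → Dec A → ¬ (A → B) → A × ¬ B
¬-→ (yes a) ¬A→B = a , λ b → ¬A→B (λ _ → b)
¬-→ (no ¬a) ¬A→B = ⊥-elim (¬A→B (⊥-elim ∘ ¬a))

counterexample : ∀ {n} {P Q : Pred (Fin n) 0ℓ} → Decidable P → Decidable Q →
                 ¬ (∀ z → P z → Q z) → ∃ λ z → P z × ¬ Q z
counterexample {n} {P} {Q} P? Q? ¬∀ with ¬∀⟶∃¬ n (λ z → P z → Q z) (λ z → P? z →-dec Q? z) ¬∀
... | z , ¬P→Q = z , ¬-→ (P? z) ¬P→Q

anyᵇ : ∀ {n} → (Fin n → Bool) → Bool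
anyᵇ f = does (any? (λ u → f u ≟ᵇ true))

anyᵇ⁺ : ∀ {n} (f : Fin n → Bool) {u} → f u ≡ true → anyᵇ f ≡ true
anyᵇ⁺ f fu = dec-true (any? (λ u → f u ≟ᵇ true)) (_ , fu)

anyᵇ⁻ : ∀ {n} (f : Fin n → Bool) → anyᵇ f ≡ true → ∃ λ u → f u ≡ true
anyᵇ⁻ f = does-true⁻ (any? (λ u → f u ≟ᵇ true))

module VertexSets {n : ℕ} where

  _⊆_ : (Fin n → Bool) → (Fin n → Bool) → Set
  W ⊆ W′ = ∀ v → W v ≡ true → W′ v ≡ true

  size : (Fin n → Bool) → ℕ
  size W = ∣ tabulate W ∣

  ∈-tabulate⁺ : ∀ {W : Fin n → Bool} {v} → W v ≡ true → v ∈ tabulate W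
  ∈-tabulate⁺ {W} {v} Wv = lookup⇒[]= v (tabulate W) (trans (lookup∘tabulate W v) Wv)

  ∈-tabulate⁻ : ∀ {W : Fin n → Bool} {v} → v ∈ tabulate W → W v ≡ true
  ∈-tabulate⁻ {W} {v} v∈W = trans (sym (lookup∘tabulate W v)) ([]=⇒lookup v∈W)

  size-mono-< : ∀ {W W′} → W ⊆ W′ → ∀ w → W′ w ≡ true → W w ≡ false → size W < size W′
  size-mono-< W⊆W′ w W′w ¬Ww = p⊂q⇒∣p∣<∣q∣ W⊂W′
    where
      W⊂W′ : tabulate _ ⊂ tabulate _
      W⊂W′ = (∈-tabulate⁺ ∘ W⊆W′ _ ∘ ∈-tabulate⁻) , w , ∈-tabulate⁺ W′w ,
             λ w∈W → ≡true⇒≢false (∈-tabulate⁻ w∈W) ¬Ww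

  size≤n : ∀ W → size W ≤ n
  size≤n W = ∣p∣≤n (tabulate W)

distinct-members : ∀ {n} (p : Subset n) k → k ≤ ∣ p ∣ →
                   Σ (Fin k → Fin n) λ g → Injective _≡_ _≡_ g × (∀ i → g i ∈ p)
distinct-members p zero _ = (λ ()) , (λ { {()} }) , λ ()
distinct-members (false ∷ p) k k≤∣p∣ with distinct-members p k k≤∣p∣
... | g , g-inj , g∈p = fsuc ∘ g , g-inj ∘ fsuc-injective , there ∘ g∈p
distinct-members (true ∷ p) (suc k) k≤∣p∣ with distinct-members p k (s≤s⁻¹ k≤∣p∣)
... | g , g-inj , g∈p = g′ , g′-inj , g′∈p
  where
    g′ : Fin (suc k) → Fin _
    g′ fzero = fzero
    g′ (fsuc i) = fsuc (g i)
    g′-inj : Injective _≡_ _≡_ g′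
    g′-inj {fzero} {fzero} _ = refl
    g′-inj {fsuc i} {fsuc j} e = cong fsuc (g-inj (fsuc-injective e))
    g′∈p : ∀ i → g′ i ∈ (true ∷ p)
    g′∈p fzero = here
    g′∈p (fsuc i) = there (g∈p i)

extremum : ∀ {n} {P : Pred (Fin n) 0ℓ} → Decidable P →
           (_≼_ : ℕ → ℕ → Set) → Transitive _≼_ → Total _≼_ →
           (f : Fin n → ℕ) → ∃ P → ∃ λ y → P y × (∀ y′ → P y′ → f y ≼ f y′)
extremum {suc n} {P} P? _≼_ ≼-trans ≼-total f (w , Pw) with any? (P? ∘ fsuc)
... | no ¬Ptail = fzero , P-head w Pw , λ { fzero _ → reduce (≼-total _ _) ; (fsuc y) Py → ⊥-elim (¬Ptail (y , Py)) }
  where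
    P-head : ∀ w → P w → P fzero
    P-head fzero Pw = Pw
    P-head (fsuc w′) Pw = ⊥-elim (¬Ptail (w′ , Pw))
... | yes ∃Ptail with extremum (P? ∘ fsuc) _≼_ ≼-trans ≼-total (f ∘ fsuc) ∃Ptail | P? fzero
...   | y , Py , opt | no ¬P0 = fsuc y , Py , λ { fzero P0 → ⊥-elim (¬P0 P0) ; (fsuc y′) Py′ → opt y′ Py′ }
...   | y , Py , opt | yes P0 with ≼-total (f (fsuc y)) (f fzero)
...     | inj₁ y≼0 = fsuc y , Py , λ { fzero _ → y≼0 ; (fsuc y′) Py′ → opt y′ Py′ }
...     | inj₂ 0≼y = fzero , P0 , λ { fzero _ → reduce (≼-total _ _) ; (fsuc y′) Py′ → ≼-trans 0≼y (opt y′ Py′) }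

argmin : ∀ {n} {P : Pred (Fin n) 0ℓ} → Decidable P → (f : Fin n → ℕ) → ∃ P →
         ∃ λ y → P y × (∀ y′ → P y′ → f y ≤ f y′)
argmin P? = extremum P? _≤_ ≤-trans ≤-total

argmax : ∀ {n} {P : Pred (Fin n) 0ℓ} → Decidable P → (f : Fin n → ℕ) → ∃ P →
         ∃ λ y → P y × (∀ y′ → P y′ → f y′ ≤ f y)
argmax P? = extremum P? (flip _≤_) (flip ≤-trans) (flip ≤-total)

least : ∀ {P : Pred ℕ 0ℓ} → Decidable P → ∀ {m} → P m → ∃ λ k → P k × (∀ i → i < k → ¬ P i)
least {P} P? {m} = <-rec (λ m → P m → ∃ λ k → P k × (∀ i → i < k → ¬ P i)) step m
  where
    step : ∀ m → (∀ {i} → i < m → P i → ∃ λ k → P k × (∀ i → i < k → ¬ P i)) →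
           P m → ∃ λ k → P k × (∀ i → i < k → ¬ P i)
    step m rec Pm with any? {n = m} (P? ∘ toℕ)
    ... | yes (i , Pi) = rec (toℕ<n i) Pi
    ... | no none = m , Pm , λ i i<m Pi → none (fromℕ< i<m , subst P (sym (toℕ-fromℕ< i<m)) Pi)

greatest≤ : ∀ {P : Pred ℕ 0ℓ} → Decidable P → P 0 → ∀ k →
            ∃ λ j → j ≤ k × P j × (∀ l → j < l → l ≤ k → ¬ P l)
greatest≤ P? P0 zero = 0 , z≤n , P0 , λ l 0<l l≤0 → ⊥-elim (<⇒≱ 0<l l≤0)
greatest≤ P? P0 (suc k) with P? (suc k) | greatest≤ P? P0 k
... | yes Pk | _ = suc k , ≤-refl , Pk , λ l k<l l≤k → ⊥-elim (<⇒≱ k<l l≤k)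
... | no ¬Pk | j , j≤k , Pj , above = j , m≤n⇒m≤1+n j≤k , Pj , none-above
  where
    none-above : ∀ l → j < l → l ≤ suc k → ¬ _
    none-above l j<l l≤1+k with m≤n⇒m<n∨m≡n l≤1+k
    ... | inj₁ l<1+k = above l j<l (s≤s⁻¹ l<1+k)
    ... | inj₂ refl = ¬Pk

cnext-cases : ∀ {m} (i : Fin (suc m)) →
              (toℕ i < m × toℕ (cnext i) ≡ suc (toℕ i)) ⊎ (toℕ i ≡ m × toℕ (cnext i) ≡ 0)
cnext-cases {m} i with toℕ i <? m
... | yes i<m = inj₁ (i<m , trans (toℕ-fromℕ< _) (m<n⇒m%n≡m (s≤s i<m)))
... | no i≮m = inj₂ (i≡m , trans (toℕ-fromℕ< _) (trans (cong (λ x → suc x % suc m) i≡m) (n%n≡0 (suc m))))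
  where
    i≡m : toℕ i ≡ m
    i≡m = ≤∧≮⇒≡ (s≤s⁻¹ (toℕ<n i)) i≮m

consecutive-step : ∀ {m} (i j : Fin (suc m)) → toℕ j ≡ suc (toℕ i) → Consecutive i j
consecutive-step i j j≡1+i with cnext-cases i
... | inj₁ (_ , next≡1+i) = inj₁ (toℕ-injective (trans j≡1+i (sym next≡1+i)))
... | inj₂ (i≡m , _) = ⊥-elim (1+n≰n (≤-trans (≤-reflexive (trans (cong suc (sym i≡m)) (sym j≡1+i))) (s≤s⁻¹ (toℕ<n j))))

consecutive-wrap : ∀ {m} (i j : Fin (suc m)) → toℕ i ≡ m → toℕ j ≡ 0 → Consecutive i j
consecutive-wrap i j i≡m j≡0 with cnext-cases i
... | inj₁ (i<m , _) = ⊥-elim (<⇒≢ i<m i≡m)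
... | inj₂ (_ , next≡0) = inj₁ (toℕ-injective (trans j≡0 (sym next≡0)))

consecutive-sym : ∀ {m} {i j : Fin (suc m)} → Consecutive i j → Consecutive j i
consecutive-sym (inj₁ j≡next) = inj₂ j≡next
consecutive-sym (inj₂ i≡next) = inj₁ i≡next

prepend : ∀ {n} → Fin n → (ℕ → Fin n) → ℕ → Fin n
prepend w p zero = w
prepend w p (suc i) = p i

module GraphTheory {n : ℕ} (G : Graph n) where

  A : Fin n → Fin n → Set
  A = Adj G

  A-sym : ∀ {u v} → A u v → A v u
  A-sym {u} {v} = trans (Graph.sym G v u)

  A-irrefl : ∀ {u} → ¬ A u u
  A-irrefl {u} Auu = ≡true⇒≢false Auu (Graph.irrefl G u)

  NbhdSub : (Fin n → Bool) → Fin n → Fin n → Set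
  NbhdSub W y y′ = ∀ z → W z ≡ true → A y z → A y′ z

  NbhdSub? : ∀ W y y′ → Dec (NbhdSub W y y′)
  NbhdSub? W y y′ = all? λ z → (W z ≟ᵇ true) →-dec ((adj G y z ≟ᵇ true) →-dec (adj G y′ z ≟ᵇ true))

  ¬NbhdSub-witness : ∀ {W y y′} → ¬ NbhdSub W y y′ → ∃ λ z → W z ≡ true × A y z × ¬ A y′ z
  ¬NbhdSub-witness {W} {y} {y′} ¬sub
    with counterexample (λ z → W z ≟ᵇ true) (λ z → (adj G y z ≟ᵇ true) →-dec (adj G y′ z ≟ᵇ true)) ¬sub
  ... | z , Wz , ¬imp with ¬-→ (adj G y z ≟ᵇ true) ¬imp
  ...   | Ayz , ¬Ay′z = z , Wz , Ayz , ¬Ay′z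

  WeaklySimplicial : (Fin n → Bool) → Fin n → Set
  WeaklySimplicial W x = ∀ y y′ → W y ≡ true → W y′ ≡ true → A x y → A x y′ →
                         NbhdSub W y y′ ⊎ NbhdSub W y′ y

  WeaklySimplicial-transfer : ∀ {W W′ x} →
    (∀ y → W y ≡ true → A x y → W′ y ≡ true) →
    (∀ y z → W′ y ≡ true → A x y → W z ≡ true → A y z → W′ z ≡ true) →
    WeaklySimplicial W′ x → WeaklySimplicial W x
  WeaklySimplicial-transfer nbrs-in nbrs²-in ws y y′ Wy Wy′ Axy Axy′
    with ws y y′ (nbrs-in y Wy Axy) (nbrs-in y′ Wy′ Axy′) Axy Axy′
  ... | inj₁ sub = inj₁ λ z Wz Ayz → sub z (nbrs²-in y z (nbrs-in y Wy Axy) Axy Wz Ayz) Ayz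
  ... | inj₂ sub = inj₂ λ z Wz Ay′z → sub z (nbrs²-in y′ z (nbrs-in y′ Wy′ Axy′) Axy′ Wz Ay′z) Ay′z

  record InducedPath (p : ℕ → Fin n) (L : ℕ) : Set where
    field
      edge      : ∀ i → i < L → A (p i) (p (suc i))
      chordless : ∀ i j → i < j → j ≤ L → A (p i) (p j) → j ≡ suc i
      injective : ∀ i j → i ≤ L → j ≤ L → p i ≡ p j → i ≡ j
  open InducedPath public

  InducedPath-suffix : ∀ {p L} j → j ≤ L → InducedPath p L → InducedPath (λ i → p (j + i)) (L ∸ j)
  InducedPath-suffix {p} {L} j j≤L P = record { edge = edge′ ; chordless = chordless′ ; injective = injective′ }
    where
      bound : ∀ {i} → i ≤ L ∸ j → j + i ≤ L
      bound i≤ = ≤-trans (+-monoʳ-≤ j i≤) (≤-reflexive (m+[n∸m]≡n j≤L))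
      edge′ : ∀ i → i < L ∸ j → A (p (j + i)) (p (j + suc i))
      edge′ i i< = subst (A (p (j + i)) ∘ p) (sym (+-suc j i)) (edge P (j + i) (subst (_≤ L) (+-suc j i) (bound i<)))
      chordless′ : ∀ i i′ → i < i′ → i′ ≤ L ∸ j → A (p (j + i)) (p (j + i′)) → i′ ≡ suc i
      chordless′ i i′ i<i′ i′≤ a = +-cancelˡ-≡ j i′ (suc i)
        (trans (chordless P (j + i) (j + i′) (+-monoʳ-< j i<i′) (bound i′≤) a) (sym (+-suc j i)))
      injective′ : ∀ i i′ → i ≤ L ∸ j → i′ ≤ L ∸ j → p (j + i) ≡ p (j + i′) → i ≡ i′
      injective′ i i′ i≤ i′≤ e = +-cancelˡ-≡ j i i′ (injective P (j + i) (j + i′) (bound i≤) (bound i′≤) e)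

  InducedPath-prepend : ∀ {p L} w → InducedPath p L → A w (p 0) →
                        (∀ i → 0 < i → i ≤ L → ¬ A w (p i)) → (∀ i → i ≤ L → w ≢ p i) →
                        InducedPath (prepend w p) (suc L)
  InducedPath-prepend {p} {L} w P Aw0 ¬Awi w≢pi = record { edge = edge′ ; chordless = chordless′ ; injective = injective′ }
    where
      edge′ : ∀ i → i < suc L → A (prepend w p i) (prepend w p (suc i))
      edge′ zero _ = Aw0
      edge′ (suc i) i< = edge P i (s≤s⁻¹ i<)
      chordless′ : ∀ i j → i < j → j ≤ suc L → A (prepend w p i) (prepend w p j) → j ≡ suc i
      chordless′ zero (suc zero) _ _ _ = refl
      chordless′ zero (suc (suc j)) _ j≤ a = ⊥-elim (¬Awi (suc j) (s≤s z≤n) (s≤s⁻¹ j≤) a)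
      chordless′ (suc i) (suc j) i<j j≤ a = cong suc (chordless P i j (s≤s⁻¹ i<j) (s≤s⁻¹ j≤) a)
      injective′ : ∀ i j → i ≤ suc L → j ≤ suc L → prepend w p i ≡ prepend w p j → i ≡ j
      injective′ zero zero _ _ _ = refl
      injective′ zero (suc j) _ j≤ e = ⊥-elim (w≢pi j (s≤s⁻¹ j≤) e)
      injective′ (suc i) zero i≤ _ e = ⊥-elim (w≢pi i (s≤s⁻¹ i≤) (sym e))
      injective′ (suc i) (suc j) i≤ j≤ e = cong suc (injective P i j (s≤s⁻¹ i≤) (s≤s⁻¹ j≤) e)

  apex-chordless-cycle : ∀ {p L} w → InducedPath p L → A w (p 0) → A w (p L) →
                         (∀ i → 0 < i → i < L → ¬ A w (p i)) → (∀ i → i ≤ L → w ≢ p i) →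
                         Σ (Cycle G (suc L)) λ C → ¬ HasChord C
  apex-chordless-cycle {p} {L} w P Aw0 AwL ¬Awi w≢pi = C , λ (i , j , ¬cons , i≢j , a) → ¬cons (chord-consecutive i j i≢j a)
    where
      vt : Fin (suc (suc L)) → Fin n
      vt i = prepend w p (toℕ i)
      bound : ∀ (i : Fin (suc (suc L))) {k} → toℕ i ≡ suc k → k ≤ L
      bound i e = s≤s⁻¹ (s≤s⁻¹ (≤-trans (≤-reflexive (cong suc (sym e))) (toℕ<n i)))
      vt-injective : ∀ i j → vt i ≡ vt j → i ≡ j
      vt-injective i j e with toℕ i in ei | toℕ j in ej
      ... | zero | zero = toℕ-injective (trans ei (sym ej))
      ... | zero | suc b = ⊥-elim (w≢pi b (bound j ej) e)
      ... | suc a | zero = ⊥-elim (w≢pi a (bound i ei) (sym e))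
      ... | suc a | suc b = toℕ-injective (trans ei (trans (cong suc (injective P a b (bound i ei) (bound j ej) e)) (sym ej)))
      vt-edge : ∀ i → A (vt i) (vt (cnext i))
      vt-edge i with cnext-cases i
      ... | inj₁ (i<L+1 , next≡1+i) rewrite next≡1+i with toℕ i
      ...   | zero = Aw0
      ...   | suc a = edge P a (s≤s⁻¹ i<L+1)
      vt-edge i | inj₂ (i≡L+1 , next≡0) rewrite next≡0 | i≡L+1 = A-sym AwL
      C : Cycle G (suc L)
      C = record { vert = vt ; distinct = λ {i} {j} → vt-injective i j ; edges = vt-edge }
      chord-consecutive : ∀ i j → i ≢ j → A (vt i) (vt j) → Consecutive i j
      chord-consecutive i j i≢j = go (toℕ i) (toℕ j) refl refl
        where
          go : ∀ x y → toℕ i ≡ x → toℕ j ≡ y → A (prepend w p x) (prepend w p y) → Consecutive i j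
          go zero zero ei ej _ = ⊥-elim (i≢j (toℕ-injective (trans ei (sym ej))))
          go zero (suc zero) ei ej _ = consecutive-step i j (trans ej (cong suc (sym ei)))
          go (suc zero) zero ei ej _ = consecutive-sym (consecutive-step j i (trans ei (cong suc (sym ej))))
          go zero (suc (suc b)) ei ej a with suc b <? L
          ... | yes b<L = ⊥-elim (¬Awi (suc b) (s≤s z≤n) b<L a)
          ... | no b≮L = consecutive-sym (consecutive-wrap j i (trans ej (cong suc (≤∧≮⇒≡ (bound j ej) b≮L))) ei)
          go (suc (suc b)) zero ei ej a with suc b <? L
          ... | yes b<L = ⊥-elim (¬Awi (suc b) (s≤s z≤n) b<L (A-sym a))
          ... | no b≮L = consecutive-wrap i j (trans ei (cong suc (≤∧≮⇒≡ (bound i ei) b≮L))) ej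
          go (suc x) (suc y) ei ej a with <-cmp x y
          ... | tri< x<y _ _ = consecutive-step i j (trans ej (cong suc (trans (chordless P x y x<y (bound j ej) a) (sym ei))))
          ... | tri≈ _ x≡y _ = ⊥-elim (i≢j (toℕ-injective (trans ei (trans (cong suc x≡y) (sym ej)))))
          ... | tri> _ _ y<x =
            consecutive-sym (consecutive-step j i (trans ei (cong suc (trans (chordless P y x y<x (bound i ei) (A-sym a)) (sym ej)))))

module Bfs {n : ℕ} (G : Graph n) (H : Fin n → Bool) (s : Fin n) (s∈H : H s ≡ true) where
  open VertexSets {n}
  open GraphTheory G using (A; InducedPath)

  Ball : ℕ → Fin n → Bool
  Ball zero v = does (v ≟ᶠ s)
  Ball (suc k) v = Ball k v ∨ (H v ∧ anyᵇ (λ u → Ball k u ∧ adj G u v))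

  Ball-mono : ∀ {k k′ v} → k ≤ k′ → Ball k v ≡ true → Ball k′ v ≡ true
  Ball-mono = go ∘ ≤⇒≤′
    where
      go : ∀ {k k′ v} → k ≤′ k′ → Ball k v ≡ true → Ball k′ v ≡ true
      go (≤′-reflexive refl) = id
      go (≤′-step k≤′k′) = ∨-trueˡ ∘ go k≤′k′

  Ball⊆H : ∀ k → Ball k ⊆ H
  Ball⊆H zero v v≡s = subst (λ u → H u ≡ true) (sym (does-true⁻ (v ≟ᶠ s) v≡s)) s∈H
  Ball⊆H (suc k) v e with ∨-true⁻ e
  ... | inj₁ old = Ball⊆H k v old
  ... | inj₂ new = ∧-trueˡ new

  Ball-step : ∀ k {u v} → Ball k u ≡ true → H v ≡ true → A u v → Ball (suc k) v ≡ true
  Ball-step k Bu Hv Auv = ∨-trueʳ (∧-true⁺ Hv (anyᵇ⁺ (λ u → Ball k u ∧ adj G u _) (∧-true⁺ Bu Auv)))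

  Ball-back : ∀ k {v} → Ball (suc k) v ≡ true → Ball k v ≡ false → ∃ λ u → Ball k u ≡ true × A u v
  Ball-back k e ¬old with ∨-true⁻ e
  ... | inj₁ old = ⊥-elim (≡true⇒≢false old ¬old)
  ... | inj₂ new with anyᵇ⁻ (λ u → Ball k u ∧ adj G u _) (∧-trueʳ new)
  ...   | u , Bu∧Auv = u , ∧-trueˡ Bu∧Auv , ∧-trueʳ Bu∧Auv

  Stable : ℕ → Set
  Stable k = Ball (suc k) ⊆ Ball k

  stable-mono : ∀ {k k′} → k ≤ k′ → Stable k → Stable k′
  stable-mono = go ∘ ≤⇒≤′
    where
      stable-suc : ∀ k → Stable k → Stable (suc k)
      stable-suc k st v e with ∨-true⁻ e
      ... | inj₁ old = old
      ... | inj₂ new with anyᵇ⁻ (λ u → Ball (suc k) u ∧ adj G u v) (∧-trueʳ new)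
      ...   | u , Bu∧Auv = Ball-step k (st u (∧-trueˡ Bu∧Auv)) (∧-trueˡ new) (∧-trueʳ Bu∧Auv)
      go : ∀ {k k′} → k ≤′ k′ → Stable k → Stable k′
      go (≤′-reflexive refl) = id
      go {k′ = suc k′} (≤′-step k≤′k′) st = stable-suc k′ (go k≤′k′ st)

  unstable-grows : ∀ k → ¬ Stable k → size (Ball k) < size (Ball (suc k))
  unstable-grows k ¬st with counterexample (λ v → Ball (suc k) v ≟ᵇ true) (λ v → Ball k v ≟ᵇ true) ¬st
  ... | v , new , ¬old = size-mono-< (λ _ → ∨-trueˡ) v new (≢true⇒≡false ¬old)

  -- Each unstable round adds a vertex, so there are at most n of them.
  stable : Stable n
  stable with all? (λ v → (Ball (suc n) v ≟ᵇ true) →-dec (Ball n v ≟ᵇ true))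
  ... | yes st = st
  ... | no ¬st = ⊥-elim (1+n≰n (≤-trans (grows (suc n) ≤-refl) (size≤n (Ball (suc n)))))
    where
      grows : ∀ k → k ≤ suc n → k ≤ size (Ball k)
      grows zero _ = z≤n
      grows (suc k) k<1+n = ≤-trans (s≤s (grows k (m≤n⇒m≤1+n (s≤s⁻¹ k<1+n))))
                                    (unstable-grows k (¬st ∘ stable-mono (s≤s⁻¹ k<1+n)))

  Ball-closed : ∀ {u v} → Ball n u ≡ true → H v ≡ true → A u v → Ball n v ≡ true
  Ball-closed Bu Hv Auv = stable _ (Ball-step n Bu Hv Auv)

  Sphere : ℕ → Fin n → Set
  Sphere zero v = Ball 0 v ≡ true
  Sphere (suc k) v = Ball (suc k) v ≡ true × Ball k v ≡ false

  Sphere⊆Ball : ∀ k {v} → Sphere k v → Ball k v ≡ true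
  Sphere⊆Ball zero = id
  Sphere⊆Ball (suc k) = proj₁

  Sphere-Ball-disjoint : ∀ {i j w} → i < j → Sphere j w → Ball i w ≢ true
  Sphere-Ball-disjoint {j = suc j} i<j (_ , ¬Bjw) Biw = ≡true⇒≢false (Ball-mono (s≤s⁻¹ i<j) Biw) ¬Bjw

  Sphere-back : ∀ k {u v} → Sphere (suc k) v → Ball k u ≡ true → A u v → Sphere k u
  Sphere-back zero _ Bu _ = Bu
  Sphere-back (suc k) {u} (Bv , ¬B′v) Bu Auv with Ball k u in Bk
  ... | true = ⊥-elim (≡true⇒≢false (Ball-step k Bk (Ball⊆H (suc (suc k)) _ Bv) Auv) ¬B′v)
  ... | false = Bu , refl

  Geodesic : ℕ → (ℕ → Fin n) → Set
  Geodesic k q = (∀ i → i ≤ k → Sphere i (q i)) × (∀ i → i < k → A (q i) (q (suc i)))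

  update : (ℕ → Fin n) → ℕ → Fin n → ℕ → Fin n
  update q m v i with i ≟ m
  ... | yes _ = v
  ... | no _ = q i

  update-≡ : ∀ q m v → update q m v m ≡ v
  update-≡ q m v with m ≟ m
  ... | yes _ = refl
  ... | no m≢m = ⊥-elim (m≢m refl)

  update-≢ : ∀ q m v {i} → i ≢ m → update q m v i ≡ q i
  update-≢ q m v {i} i≢m with i ≟ m
  ... | yes i≡m = ⊥-elim (i≢m i≡m)
  ... | no _ = refl

  geodesic : ∀ k {v} → Sphere k v → Σ (ℕ → Fin n) λ q → q k ≡ v × Geodesic k q
  geodesic zero {v} Sv = (λ _ → v) , refl , (λ { zero _ → Sv }) , λ _ ()
  geodesic (suc k) {v} Sv with Ball-back k (proj₁ Sv) (proj₂ Sv)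
  ... | u , Bu , Auv with geodesic k (Sphere-back k Sv Bu Auv)
  ...   | q , qk≡u , spheres , edges = q′ , update-≡ q (suc k) v , spheres′ , edges′
    where
      q′ = update q (suc k) v
      spheres′ : ∀ i → i ≤ suc k → Sphere i (q′ i)
      spheres′ i i≤ with m≤n⇒m<n∨m≡n i≤
      ... | inj₂ refl = subst (Sphere (suc k)) (sym (update-≡ q (suc k) v)) Sv
      ... | inj₁ i<  = subst (Sphere i) (sym (update-≢ q (suc k) v (<⇒≢ i<))) (spheres i (s≤s⁻¹ i<))
      edges′ : ∀ i → i < suc k → A (q′ i) (q′ (suc i))
      edges′ i i< with m≤n⇒m<n∨m≡n (s≤s⁻¹ i<)
      ... | inj₂ refl rewrite update-≡ q (suc k) v | update-≢ q (suc k) v (<⇒≢ i<) = subst (λ x → A x v) (sym qk≡u) Auv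
      ... | inj₁ i<k rewrite update-≢ q (suc k) v (<⇒≢ i<) | update-≢ q (suc k) v (<⇒≢ (s≤s i<k)) = edges i i<k

  geodesic-induced : ∀ {k q} → Geodesic k q → InducedPath q k
  geodesic-induced {k} {q} (spheres , edges) = record { edge = edges ; chordless = chordless′ ; injective = injective′ }
    where
      ball : ∀ {i} → i ≤ k → Ball i (q i) ≡ true
      ball i≤k = Sphere⊆Ball _ (spheres _ i≤k)
      chordless′ : ∀ i j → i < j → j ≤ k → A (q i) (q j) → j ≡ suc i
      chordless′ i j i<j j≤k a with j ≟ suc i
      ... | yes j≡1+i = j≡1+i
      ... | no j≢1+i = ⊥-elim (Sphere-Ball-disjoint (≤∧≢⇒< i<j (j≢1+i ∘ sym)) (spheres j j≤k)
                          (Ball-step i (ball (≤-trans (<⇒≤ i<j) j≤k)) (Ball⊆H j _ (ball j≤k)) a))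
      injective′ : ∀ i j → i ≤ k → j ≤ k → q i ≡ q j → i ≡ j
      injective′ i j i≤k j≤k e with <-cmp i j
      ... | tri≈ _ i≡j _ = i≡j
      ... | tri< i<j _ _ = ⊥-elim (Sphere-Ball-disjoint i<j (spheres j j≤k) (subst (λ x → Ball i x ≡ true) e (ball i≤k)))
      ... | tri> _ _ j<i = ⊥-elim (Sphere-Ball-disjoint j<i (spheres i i≤k) (subst (λ x → Ball j x ≡ true) (sym e) (ball j≤k)))

module WeakSimpliciality {n : ℕ} (G : Graph n) (c : Fin n → Bool)
  (proper : ∀ u v → Adj G u v → c u ≢ c v)
  (chordal : ∀ m → 6 ≤ suc m → (C : Cycle G m) → HasChord C) where
  open VertexSets {n}
  open GraphTheory G

  adj-from-false : ∀ {u v} → A u v → c u ≡ false → c v ≡ true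
  adj-from-false {u} {v} Auv cu with c v in cv
  ... | true = refl
  ... | false = ⊥-elim (proper u v Auv (trans cu (sym cv)))

  adj-from-true : ∀ {u v} → A u v → c u ≡ true → c v ≡ false
  adj-from-true {u} {v} Auv cu with c v in cv
  ... | false = refl
  ... | true = ⊥-elim (proper u v Auv (trans cu (sym cv)))

  colour-distinct : ∀ {u v} → c u ≡ false → c v ≡ true → u ≢ v
  colour-distinct cu cv refl = ≡true⇒≢false cv cu

  second-nbr-colour : ∀ {x y z} → c x ≡ false → A x y → A y z → c z ≡ false
  second-nbr-colour cx Axy Ayz = adj-from-true Ayz (adj-from-false Axy cx)

  no-long-apex-path : ∀ {p L} w → 4 ≤ L → InducedPath p L → A w (p 0) → A w (p L) →
                      (∀ i → 0 < i → i < L → ¬ A w (p i)) → (∀ i → i ≤ L → w ≢ p i) → ⊥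
  no-long-apex-path {L = L} w 4≤L P Aw0 AwL ¬Awi w≢pi with apex-chordless-cycle w P Aw0 AwL ¬Awi w≢pi
  ... | C , ¬chord = ¬chord (chordal (suc L) (s≤s (s≤s 4≤L)) C)

  Complete : (Fin n → Bool) → Fin n → Set
  Complete W y = ∀ z → W z ≡ true → c z ≡ false → A y z

  Complete? : ∀ W y → Dec (Complete W y)
  Complete? W y = all? λ z → (W z ≟ᵇ true) →-dec ((c z ≟ᵇ false) →-dec (adj G y z ≟ᵇ true))

  ¬Complete-witness : ∀ {W y} → ¬ Complete W y → ∃ λ z → W z ≡ true × c z ≡ false × ¬ A y z
  ¬Complete-witness {W} {y} ¬comp
    with counterexample (λ z → W z ≟ᵇ true) (λ z → (c z ≟ᵇ false) →-dec (adj G y z ≟ᵇ true)) ¬comp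
  ... | z , Wz , ¬imp with ¬-→ (c z ≟ᵇ false) ¬imp
  ...   | cz , ¬Ayz = z , Wz , cz , ¬Ayz

  delete : (Fin n → Bool) → Fin n → Fin n → Bool
  delete W y v = W v ∧ not (does (v ≟ᶠ y))

  delete⊆ : ∀ {W y} → delete W y ⊆ W
  delete⊆ _ = ∧-trueˡ

  delete⁺ : ∀ {W y v} → W v ≡ true → v ≢ y → delete W y v ≡ true
  delete⁺ {y = y} {v} Wv v≢y rewrite dec-false (v ≟ᶠ y) v≢y | Wv = refl

  size-delete : ∀ {W y} → W y ≡ true → size (delete W y) < size W
  size-delete {W} {y} Wy = size-mono-< delete⊆ y Wy deleted
    where
      deleted : delete W y y ≡ false
      deleted rewrite dec-true (y ≟ᶠ y) refl = ∧-zeroʳ (W y)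

  WeaklySimplicial-delete-nonneighbour : ∀ {W y x} → c y ≡ true → c x ≡ false → ¬ A x y →
    WeaklySimplicial (delete W y) x → WeaklySimplicial W x
  WeaklySimplicial-delete-nonneighbour {W} cy cx ¬Axy = WeaklySimplicial-transfer
    (λ y′ Wy′ Axy′ → delete⁺ {W} Wy′ λ { refl → ¬Axy Axy′ })
    (λ y′ z _ Axy′ Wz Ay′z → delete⁺ {W} Wz (colour-distinct (second-nbr-colour cx Axy′ Ay′z) cy))

  WeaklySimplicial-delete-complete : ∀ {W y x} → c y ≡ true → Complete W y → c x ≡ false →
    WeaklySimplicial (delete W y) x → WeaklySimplicial W x
  WeaklySimplicial-delete-complete {W} {y} {x} cy comp cx ws y₁ y₂ Wy₁ Wy₂ Axy₁ Axy₂ with y₁ ≟ᶠ y | y₂ ≟ᶠ y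
  ... | yes refl | _ = inj₂ λ z Wz Ay₂z → comp z Wz (second-nbr-colour cx Axy₂ Ay₂z)
  ... | no _ | yes refl = inj₁ λ z Wz Ay₁z → comp z Wz (second-nbr-colour cx Axy₁ Ay₁z)
  ... | no y₁≢y | no y₂≢y with ws y₁ y₂ (delete⁺ {W} Wy₁ y₁≢y) (delete⁺ {W} Wy₂ y₂≢y) Axy₁ Axy₂
  ...   | inj₁ sub = inj₁ λ z Wz Ay₁z → sub z (delete⁺ {W} Wz (colour-distinct (second-nbr-colour cx Axy₁ Ay₁z) cy)) Ay₁z
  ...   | inj₂ sub = inj₂ λ z Wz Ay₂z → sub z (delete⁺ {W} Wz (colour-distinct (second-nbr-colour cx Axy₂ Ay₂z) cy)) Ay₂z

  N₀ : (Fin n → Bool) → Fin n → Fin n → Bool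
  N₀ W y₀ v = W v ∧ (not (c v) ∧ adj G y₀ v)

  N₀⁺ : ∀ {W y₀ v} → W v ≡ true → c v ≡ false → A y₀ v → N₀ W y₀ v ≡ true
  N₀⁺ Wv cv A₀v = ∧-true⁺ Wv (∧-true⁺ (cong not cv) A₀v)

  N₀⁻ : ∀ {W y₀ v} → N₀ W y₀ v ≡ true → W v ≡ true × c v ≡ false × A y₀ v
  N₀⁻ {W} {y₀} {v} e = ∧-trueˡ {W v} e , not-injective (∧-trueˡ {not (c v)} rest) , ∧-trueʳ {not (c v)} rest
    where
      rest : not (c v) ∧ adj G y₀ v ≡ true
      rest = ∧-trueʳ {W v} e

  N₀-true-coloured : ∀ {W y₀ v} → c v ≡ true → N₀ W y₀ v ≡ false
  N₀-true-coloured {W} {v = v} cv rewrite cv = ∧-zeroʳ (W v)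

  N₀-nonadjacent : ∀ {W y₀ v} → ¬ A y₀ v → N₀ W y₀ v ≡ false
  N₀-nonadjacent {W} {y₀} ¬A₀v = ≢true⇒≡false (¬A₀v ∘ proj₂ ∘ proj₂ ∘ N₀⁻ {W} {y₀})

  coverage : (Fin n → Bool) → Fin n → Fin n → ℕ
  coverage W y₀ y = size (λ v → N₀ W y₀ v ∧ adj G y v)

  Candidate : (Fin n → Bool) → Fin n → Fin n → Set
  Candidate W y₀ x = W x ≡ true × c x ≡ false × ¬ A y₀ x

  Witness : (Fin n → Bool) → Fin n → Set
  Witness W y₀ = ∃ λ x → Candidate W y₀ x × WeaklySimplicial W x

  Claim : (Fin n → Bool) → Set
  Claim W = ∀ y₀ → ∃ (Candidate W y₀) → Witness W y₀

  ClaimBelow : (Fin n → Bool) → Set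
  ClaimBelow W = ∀ {W′} → size W′ < size W → Claim W′

  recurse-delete : ∀ {W y₀ y} → ClaimBelow W → W y ≡ true → c y ≡ true →
                   ∃ (Candidate W y₀) → ∃ λ x → Candidate W y₀ x × WeaklySimplicial (delete W y) x
  recurse-delete {W} {y₀} {y} rec Wy cy (xd , Wxd , cxd , ¬A₀xd)
    with rec (size-delete Wy) y₀ (xd , delete⁺ {W} Wxd (colour-distinct cxd cy) , cxd , ¬A₀xd)
  ... | x , (W′x , cx , ¬A₀x) , ws = x , (delete⊆ {W} {y} x W′x , cx , ¬A₀x) , ws

  witness-delete-dominated : ∀ {W y₀ y} → ClaimBelow W → W y ≡ true → c y ≡ true → NbhdSub W y y₀ →
                             ∃ (Candidate W y₀) → Witness W y₀
  witness-delete-dominated rec Wy cy dom cand with recurse-delete rec Wy cy cand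
  ... | x , (Wx , cx , ¬A₀x) , ws = x , (Wx , cx , ¬A₀x) ,
    WeaklySimplicial-delete-nonneighbour cy cx (λ Axy → ¬A₀x (dom x Wx (A-sym Axy))) ws

  witness-delete-complete : ∀ {W y₀ y} → ClaimBelow W → W y ≡ true → c y ≡ true → Complete W y →
                            ∃ (Candidate W y₀) → Witness W y₀
  witness-delete-complete rec Wy cy comp cand with recurse-delete rec Wy cy cand
  ... | x , cand′@(_ , cx , _) , ws = x , cand′ , WeaklySimplicial-delete-complete cy comp cx ws

  -- It suffices to avoid y₁: a vertex of colour false missed by y₁ is missed by y₀ too.
  witness-covering : ∀ {W y₀ y₁} → ClaimBelow W → W y₁ ≡ true → c y₁ ≡ true →
                     (∀ z → N₀ W y₀ z ≡ true → A y₁ z) → ¬ Complete W y₁ → Witness W y₀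
  witness-covering {W} {y₀} {y₁} rec Wy₁ cy₁ covers ¬comp
    with recurse-delete rec Wy₁ cy₁ (¬Complete-witness ¬comp)
  ... | x , (Wx , cx , ¬Ay₁x) , ws = x , (Wx , cx , ¬A₀x) ,
    WeaklySimplicial-delete-nonneighbour cy₁ cx (¬Ay₁x ∘ A-sym) ws
    where
      ¬A₀x : ¬ A y₀ x
      ¬A₀x A₀x = ¬Ay₁x (covers x (N₀⁺ {W} Wx cx A₀x))

  module LastCase {W y₀ xd} (rec : ClaimBelow W) (cand : Candidate W y₀ xd)
      (¬dominated : ∀ y → W y ≡ true → c y ≡ true → ¬ NbhdSub W y y₀)
      {y₁} (Wy₁ : W y₁ ≡ true) (cy₁ : c y₁ ≡ true)
      (y₁-max : ∀ y → W y ≡ true × c y ≡ true → coverage W y₀ y ≤ coverage W y₀ y₁)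
      {a} (N₀a : N₀ W y₀ a ≡ true) (¬Ay₁a : ¬ A y₁ a) where

    Z : Fin n → Bool
    Z = N₀ W y₀

    Wa : W a ≡ true
    Wa = proj₁ (N₀⁻ {W} N₀a)

    ca : c a ≡ false
    ca = proj₁ (proj₂ (N₀⁻ {W} N₀a))

    A₀a : A y₀ a
    A₀a = proj₂ (proj₂ (N₀⁻ {W} N₀a))

    cy₀ : c y₀ ≡ true
    cy₀ = adj-from-false (A-sym A₀a) ca

    y₀∉W : W y₀ ≢ true
    y₀∉W Wy₀ = ¬dominated y₀ Wy₀ cy₀ (λ _ _ → id)

    H : Fin n → Bool
    H v = W v ∧ not (Z v)

    H⁺ : ∀ {v} → W v ≡ true → Z v ≡ false → H v ≡ true
    H⁺ Wv ¬Zv = ∧-true⁺ Wv (cong not ¬Zv)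

    H⊆W : H ⊆ W
    H⊆W v = ∧-trueˡ {W v}

    H-disjoint-Z : ∀ {v} → H v ≡ true → Z v ≡ false
    H-disjoint-Z {v} Hv = not-injective (∧-trueʳ {W v} Hv)

    ¬A₀H : ∀ {v} → H v ≡ true → ¬ A y₀ v
    ¬A₀H {v} Hv A₀v with c v ≟ᵇ true
    ... | yes cv = proper y₀ v A₀v (trans cy₀ (sym cv))
    ... | no ¬cv = ≡true⇒≢false (N₀⁺ {W} (H⊆W v Hv) (≢true⇒≡false ¬cv) A₀v) (H-disjoint-Z {v} Hv)

    open Bfs G H y₁ (H⁺ Wy₁ (N₀-true-coloured {W} cy₁))

    y₁∈Ball : Ball n y₁ ≡ true
    y₁∈Ball = Ball-mono {k′ = n} {v = y₁} z≤n (dec-true (y₁ ≟ᶠ y₁) refl)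

    -- the component of y₁ in H, together with Z
    Core : Fin n → Bool
    Core u = Ball n u ∨ Z u

    Core⊆W : Core ⊆ W
    Core⊆W u Core-u with ∨-true⁻ Core-u
    ... | inj₁ Bu = H⊆W u (Ball⊆H n u Bu)
    ... | inj₂ Zu = proj₁ (N₀⁻ {W} Zu)

    Core-true⇒Ball : ∀ {u} → Core u ≡ true → c u ≡ true → Ball n u ≡ true
    Core-true⇒Ball Core-u cu with ∨-true⁻ Core-u
    ... | inj₁ Bu = Bu
    ... | inj₂ Zu = ⊥-elim (≡true⇒≢false Zu (N₀-true-coloured {W} cu))

    Core-transfer : ∀ {x} → Core x ≡ true → c x ≡ false → ¬ A y₀ x →
                    WeaklySimplicial Core x → WeaklySimplicial W x
    Core-transfer {x} Core-x cx ¬A₀x = WeaklySimplicial-transfer nbrs-in nbrs²-in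
      where
        x∈Ball : Ball n x ≡ true
        x∈Ball with ∨-true⁻ Core-x
        ... | inj₁ Bx = Bx
        ... | inj₂ Zx = ⊥-elim (¬A₀x (proj₂ (proj₂ (N₀⁻ {W} Zx))))
        nbrs-in : ∀ y → W y ≡ true → A x y → Core y ≡ true
        nbrs-in y Wy Axy = ∨-trueˡ (Ball-closed x∈Ball (H⁺ Wy (N₀-true-coloured {W} (adj-from-false Axy cx))) Axy)
        nbrs²-in : ∀ y z → Core y ≡ true → A x y → W z ≡ true → A y z → Core z ≡ true
        nbrs²-in y z Core-y Axy Wz Ayz with Z z ≟ᵇ true
        ... | yes Zz = ∨-trueʳ Zz
        ... | no ¬Zz = ∨-trueˡ (Ball-closed (Core-true⇒Ball Core-y (adj-from-false Axy cx)) (H⁺ Wz (≢true⇒≡false ¬Zz)) Ayz)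

    witness-outside-Core : ∀ {v} → W v ≡ true → Core v ≡ false → Witness W y₀
    witness-outside-Core {v} Wv v∉Core with ¬NbhdSub-witness (¬dominated y₁ Wy₁ cy₁)
    ... | z₀ , Wz₀ , Ay₁z₀ , ¬A₀z₀
      with rec (size-mono-< Core⊆W v Wv v∉Core) y₀ (z₀ , ∨-trueˡ z₀∈Ball , adj-from-true Ay₁z₀ cy₁ , ¬A₀z₀)
      where
        z₀∈Ball : Ball n z₀ ≡ true
        z₀∈Ball = Ball-closed y₁∈Ball (H⁺ Wz₀ (N₀-nonadjacent {W} ¬A₀z₀)) Ay₁z₀
    ...   | x , (Core-x , cx , ¬A₀x) , ws = x , (Core⊆W x Core-x , cx , ¬A₀x) , Core-transfer Core-x cx ¬A₀x ws

    xd≢a : xd ≢ a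
    xd≢a refl = proj₂ (proj₂ cand) A₀a

    witness-isolated : (∀ y → W y ≡ true → ¬ A a y) → Witness W y₀
    witness-isolated iso with rec (size-delete Wa) y₀ (xd , delete⁺ {W} (proj₁ cand) xd≢a , proj₂ cand)
    ... | x , (W′x , cx , ¬A₀x) , ws = x , (delete⊆ {W} x W′x , cx , ¬A₀x) , WeaklySimplicial-transfer
      (λ y Wy Axy → delete⁺ {W} Wy λ { refl → ≡true⇒≢false (adj-from-false Axy cx) ca })
      (λ y z W′y _ Wz Ayz → delete⁺ {W} Wz λ { refl → iso y (delete⊆ {W} y W′y) (A-sym Ayz) })
      ws

    T : Fin n → Bool
    T v = H v ∧ adj G a v

    Meets : ℕ → Set
    Meets k = anyᵇ (λ w → Ball k w ∧ T w) ≡ true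

    meets⁺ : ∀ k {w} → Ball k w ≡ true → T w ≡ true → Meets k
    meets⁺ k Bw Tw = anyᵇ⁺ (λ w → Ball k w ∧ T w) (∧-true⁺ Bw Tw)

    first-sphere : ∀ {k v} → (∀ i → i < k → ¬ Meets i) → Ball k v ≡ true → T v ≡ true → Sphere k v
    first-sphere {zero} _ Bv _ = Bv
    first-sphere {suc k} {v} k-min Bv Tv with Ball k v ≟ᵇ true
    ... | yes B′v = ⊥-elim (k-min k ≤-refl (meets⁺ k B′v Tv))
    ... | no ¬B′v = Bv , ≢true⇒≡false ¬B′v

    -- q is a shortest path in H from y₁ to the neighbourhood T of a.
    module ShortestPath {k} (k-min : ∀ i → i < k → ¬ Meets i) {q} (q-geo : Geodesic k q)
                        (Tqk : T (q k) ≡ true) where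

      q-path : InducedPath q k
      q-path = geodesic-induced q-geo

      q0≡y₁ : q 0 ≡ y₁
      q0≡y₁ = does-true⁻ (q 0 ≟ᶠ y₁) (proj₁ q-geo 0 z≤n)

      q-Ball : ∀ {i} → i ≤ k → Ball i (q i) ≡ true
      q-Ball i≤k = Sphere⊆Ball _ (proj₁ q-geo _ i≤k)

      q-H : ∀ {i} → i ≤ k → H (q i) ≡ true
      q-H {i} i≤k = Ball⊆H i (q i) (q-Ball i≤k)

      ¬Aa-q : ∀ {i} → i < k → ¬ A a (q i)
      ¬Aa-q {i} i<k Aaqi = k-min i i<k (meets⁺ i (q-Ball (<⇒≤ i<k)) (∧-true⁺ (q-H (<⇒≤ i<k)) Aaqi))

      Aa-qk : A a (q k)
      Aa-qk = ∧-trueʳ {H (q k)} Tqk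

      c-qk : c (q k) ≡ true
      c-qk = adj-from-false Aa-qk ca

      -- t, q j, …, q k with j maximal is induced; y₀ and a close it to a chordless cycle of length ≥ 6.
      module Detour {t} (Zt : Z t ≡ true) (Ay₁t : A y₁ t) (¬Aqkt : ¬ A (q k) t)
                    {j} (j≤k : j ≤ k) (Atqj : A t (q j)) (beyond : ∀ l → j < l → l ≤ k → ¬ A t (q l)) where

        Wt : W t ≡ true
        Wt = proj₁ (N₀⁻ {W} Zt)

        ct : c t ≡ false
        ct = proj₁ (proj₂ (N₀⁻ {W} Zt))

        A₀t : A y₀ t
        A₀t = proj₂ (proj₂ (N₀⁻ {W} Zt))

        j<k : j < k
        j<k = ≤∧≢⇒< j≤k λ { refl → ¬Aqkt (A-sym Atqj) }

        -- q j and q k both have colour true, so they are not consecutive on q.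
        1+j<k : suc j < k
        1+j<k with m≤n⇒m<n∨m≡n j<k
        ... | inj₁ 1+j<k = 1+j<k
        ... | inj₂ refl = ⊥-elim (≡true⇒≢false c-qk (adj-from-true (edge q-path j j<k) (adj-from-false Atqj ct)))

        L : ℕ
        L = k ∸ j

        j+L≡k : j + L ≡ k
        j+L≡k = m+[n∸m]≡n j≤k

        in-range : ∀ {i} → i ≤ L → j + i ≤ k
        in-range i≤L = ≤-trans (+-monoʳ-≤ j i≤L) (≤-reflexive j+L≡k)

        seg : ℕ → Fin n
        seg i = q (j + i)

        seg-Z : ∀ {i} → i ≤ L → Z (seg i) ≡ false
        seg-Z i≤L = H-disjoint-Z (q-H (in-range i≤L))

        t-seg : InducedPath (prepend t seg) (suc L)
        t-seg = InducedPath-prepend t (InducedPath-suffix j j≤k q-path)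
          (subst (A t ∘ q) (sym (+-identityʳ j)) Atqj)
          (λ i 0<i i≤L → beyond (j + i) (m<m+n j 0<i) (in-range i≤L))
          (λ i i≤L t≡ → ≡true⇒≢false (subst (λ u → Z u ≡ true) t≡ Zt) (seg-Z i≤L))

        y₀∉t-seg : ∀ i → i ≤ suc L → y₀ ≢ prepend t seg i
        y₀∉t-seg zero _ refl = y₀∉W Wt
        y₀∉t-seg (suc i) i≤ e = y₀∉W (subst (λ u → W u ≡ true) (sym e) (H⊆W _ (q-H (in-range (s≤s⁻¹ i≤)))))

        path : InducedPath (prepend y₀ (prepend t seg)) (suc (suc L))
        path = InducedPath-prepend y₀ t-seg A₀t
          (λ { (suc i) _ i≤ → ¬A₀H (q-H (in-range (s≤s⁻¹ i≤))) })
          y₀∉t-seg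

        ¬Aa-inner : ∀ i → 0 < i → i < suc (suc L) → ¬ A a (prepend y₀ (prepend t seg) i)
        ¬Aa-inner (suc zero) _ _ Aat = proper a t Aat (trans ca (sym ct))
        ¬Aa-inner (suc (suc i)) _ i< = ¬Aa-q (≤-trans (+-monoʳ-< j (s≤s⁻¹ (s≤s⁻¹ i<))) (≤-reflexive j+L≡k))

        a∉path : ∀ i → i ≤ suc (suc L) → a ≢ prepend y₀ (prepend t seg) i
        a∉path zero _ refl = A-irrefl A₀a
        a∉path (suc zero) _ refl = ¬Ay₁a Ay₁t
        a∉path (suc (suc i)) i≤ e = ≡true⇒≢false (subst (λ u → Z u ≡ true) e N₀a) (seg-Z (s≤s⁻¹ (s≤s⁻¹ i≤)))

        impossible : ⊥
        impossible = no-long-apex-path a (s≤s (s≤s (≤-trans (≤-reflexive (sym (m+n∸n≡m 2 j))) (∸-monoˡ-≤ j 1+j<k))))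
          path (A-sym A₀a) (subst (A a ∘ q) (sym j+L≡k) Aa-qk) ¬Aa-inner a∉path

      qk-covers : ∀ {t} → Z t ≡ true → A y₁ t → A (q k) t
      qk-covers {t} Zt Ay₁t with adj G (q k) t ≟ᵇ true
      ... | yes Aqkt = Aqkt
      ... | no ¬Aqkt with greatest≤ (λ l → adj G t (q l) ≟ᵇ true) (subst (A t) (sym q0≡y₁) (A-sym Ay₁t)) k
      ...   | j , j≤k , Atqj , beyond = ⊥-elim (Detour.impossible Zt Ay₁t ¬Aqkt j≤k Atqj beyond)

      coverage-grows : coverage W y₀ y₁ < coverage W y₀ (q k)
      coverage-grows = size-mono-< covered a (∧-true⁺ N₀a (A-sym Aa-qk)) a-missed
        where
          covered : ∀ u → Z u ∧ adj G y₁ u ≡ true → Z u ∧ adj G (q k) u ≡ true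
          covered u e = ∧-true⁺ (∧-trueˡ {Z u} e) (qk-covers (∧-trueˡ {Z u} e) (∧-trueʳ {Z u} e))
          a-missed : Z a ∧ adj G y₁ a ≡ false
          a-missed rewrite ≢true⇒≡false ¬Ay₁a = ∧-zeroʳ (Z a)

      impossible : ⊥
      impossible = <⇒≱ coverage-grows (y₁-max (q k) (H⊆W _ (q-H ≤-refl) , c-qk))

    a-isolated : (∀ v → W v ≡ true → Core v ≡ true) → ∀ y → W y ≡ true → ¬ A a y
    a-isolated W⊆Core y Wy Aay with least {Meets} (λ k → anyᵇ (λ w → Ball k w ∧ T w) ≟ᵇ true) {n} meets-n
      where
        cy : c y ≡ true
        cy = adj-from-false Aay ca
        meets-n : Meets n
        meets-n = meets⁺ n (Core-true⇒Ball (W⊆Core y Wy) cy) (∧-true⁺ (H⁺ Wy (N₀-true-coloured {W} cy)) Aay)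
    ... | k , meets-k , k-min with anyᵇ⁻ (λ w → Ball k w ∧ T w) meets-k
    ...   | v , Bv∧Tv with geodesic k (first-sphere k-min (∧-trueˡ {Ball k v} Bv∧Tv) (∧-trueʳ {Ball k v} Bv∧Tv))
    ...     | q , refl , q-geo = ShortestPath.impossible k-min q-geo (∧-trueʳ {Ball k v} Bv∧Tv)

    result : Witness W y₀
    result with any? (λ v → (W v ≟ᵇ true) ×-dec (Core v ≟ᵇ false))
    ... | yes (v , Wv , v∉Core) = witness-outside-Core Wv v∉Core
    ... | no none-outside = witness-isolated (a-isolated λ v Wv → ¬-not (λ v∉Core → none-outside (v , Wv , v∉Core)))

  weakly-simplicial-vertex : ∀ W → Claim W
  weakly-simplicial-vertex = All.wfRec (On.wellFounded size <-wellFounded) 0ℓ Claim step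
    where
      step : ∀ W → ClaimBelow W → Claim W
      step W rec y₀ (xd , cand) with any? (λ y → (W y ≟ᵇ true) ×-dec (c y ≟ᵇ true) ×-dec NbhdSub? W y y₀)
      ... | yes (y , Wy , cy , dom) = witness-delete-dominated rec Wy cy dom (xd , cand)
      ... | no ¬dom with any? (λ y → (W y ≟ᵇ true) ×-dec (c y ≟ᵇ true) ×-dec Complete? W y)
      ...   | yes (y , Wy , cy , comp) = witness-delete-complete rec Wy cy comp (xd , cand)
      ...   | no ¬comp with any? (λ y → (W y ≟ᵇ true) ×-dec (c y ≟ᵇ true))
      ...     | no ¬any = xd , cand , λ y _ Wy _ Axdy _ → ⊥-elim (¬any (y , Wy , adj-from-false Axdy (proj₁ (proj₂ cand))))
      ...     | yes ∃y with argmax (λ y → (W y ≟ᵇ true) ×-dec (c y ≟ᵇ true)) (coverage W y₀) ∃y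
      ...       | y₁ , (Wy₁ , cy₁) , y₁-max with all? (λ z → (N₀ W y₀ z ≟ᵇ true) →-dec (adj G y₁ z ≟ᵇ true))
      ...         | yes covers = witness-covering rec Wy₁ cy₁ covers (λ comp → ¬comp (y₁ , Wy₁ , cy₁ , comp))
      ...         | no ¬covers with counterexample (λ z → N₀ W y₀ z ≟ᵇ true) (λ z → adj G y₁ z ≟ᵇ true) ¬covers
      ...           | a , N₀a , ¬Ay₁a = LastCase.result rec cand (λ y Wy cy dom → ¬dom (y , Wy , cy , dom))
                                          Wy₁ cy₁ y₁-max N₀a ¬Ay₁a

module Degeneracy {n : ℕ} (G : Graph n) where
  open VertexSets {n}
  open GraphTheory G

  nbrs : (Fin n → Bool) → Fin n → Fin n → Bool
  nbrs W x u = W u ∧ adj G x u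

  degree : (Fin n → Bool) → Fin n → ℕ
  degree W x = size (nbrs W x)

  biclique : ∀ {W k u v} → k ≤ degree W u → k ≤ degree W v →
             (∀ a b → nbrs W u a ≡ true → nbrs W v b ≡ true → A a b) → ContainsKkk G k
  biclique {W} {k} {u} {v} k≤deg-u k≤deg-v complete
    with distinct-members (tabulate (nbrs W u)) k k≤deg-u | distinct-members (tabulate (nbrs W v)) k k≤deg-v
  ... | f , f-inj , f∈ | g , g-inj , g∈ =
    f , g , f-inj , g-inj , (λ i j e → A-irrefl (subst (λ w → A w (g j)) e (Afg i j))) , Afg
    where
      Afg : ∀ i j → A (f i) (g j)
      Afg i j = complete (f i) (g j) (∈-tabulate⁻ (f∈ i)) (∈-tabulate⁻ (g∈ j))

  min-degree-dominated : ∀ {W x m} → WeaklySimplicial W x → nbrs W x m ≡ true →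
                         (∀ y → nbrs W x y ≡ true → degree W m ≤ degree W y) →
                         ∀ y → nbrs W x y ≡ true → NbhdSub W m y
  min-degree-dominated {W} {x} {m} ws Nm m-min y Ny
    with ws m y (∧-trueˡ {W m} Nm) (∧-trueˡ {W y} Ny) (∧-trueʳ {W m} Nm) (∧-trueʳ {W y} Ny)
  ... | inj₁ m⊆y = m⊆y
  ... | inj₂ y⊆m = λ z Wz Amz → ¬-not λ Ayz≡false →
        <⇒≱ (size-mono-< (λ u Nu → ∧-true⁺ (∧-trueˡ {W u} Nu) (y⊆m u (∧-trueˡ {W u} Nu) (∧-trueʳ {W u} Nu)))
                         z (∧-true⁺ Wz Amz) (subst (λ b → W z ∧ b ≡ false) (sym Ayz≡false) (∧-zeroʳ (W z))))
            (m-min y Ny)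

  low-degree-vertex : ∀ {W x k} → WeaklySimplicial W x → W x ≡ true → ¬ ContainsKkk G (suc k) →
                      ∃ λ v → W v ≡ true × degree W v ≤ k
  low-degree-vertex {W} {x} {k} ws Wx noK with degree W x ≤? k
  ... | yes small = x , Wx , small
  ... | no big with distinct-members (tabulate (nbrs W x)) (suc k) (≰⇒> big)
  ...   | g , _ , g∈ with argmin (λ y → nbrs W x y ≟ᵇ true) (degree W) (g fzero , ∈-tabulate⁻ (g∈ fzero))
  ...     | m , Nm , m-min with degree W m ≤? k
  ...       | yes small = m , ∧-trueˡ {W m} Nm , small
  ...       | no big′ = ⊥-elim (noK (biclique (≰⇒> big′) (≰⇒> big) complete))
    where
      complete : ∀ a b → nbrs W m a ≡ true → nbrs W x b ≡ true → A a b
      complete a b Na Nb = A-sym (min-degree-dominated ws Nm m-min b Nb a (∧-trueˡ {W a} Na) (∧-trueʳ {W a} Na))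

colouring-with-false-at : ∀ {n} {G : Graph n} → Bipartite G → ∀ v →
                          Σ (Fin n → Bool) λ c → (∀ u w → Adj G u w → c u ≢ c w) × c v ≡ false
colouring-with-false-at (c , proper) v with c v in cv
... | false = c , proper , cv
... | true = not ∘ c , (λ u w Auw → proper u w Auw ∘ not-injective) , cong not cv

lemma9 : (k : ℕ) → 1 ≤ k → {n : ℕ} → (G : Graph n) →
         ChordalBipartite G → ¬ ContainsKkk G k → Degenerate (k ∸ 1) G
lemma9 (suc k) _ G (bipartite , chordal) noK S (v , v∈S) with colouring-with-false-at {G = G} bipartite v
... | c , proper , cv
  with WeakSimpliciality.weakly-simplicial-vertex G c proper chordal (lookup S) v
         (v , []=⇒lookup v∈S , cv , GraphTheory.A-irrefl G)
...   | x , (Sx , _) , ws with Degeneracy.low-degree-vertex G ws Sx noK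
...     | u , Su , small = u , lookup⇒[]= u S Su , small
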